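{- Let $\alpha,\beta,\gamma\ge2$ be integers. If either $\alpha,\beta$ are even and $\gamma$ is odd, or $\alpha,\beta$ are odd and $\gamma\ge4$ is even, then $\Theta(\alpha,\beta,\gamma)$ admits a modified Tanaka quintuple $(v_1,v_2,v_3,v_4,v_5)$ with $v_5$ a vertex of the path $(z_0,\dots,z_\gamma)$.
   Context: For a connected graph $G=(V,E)$ with graph distance $d$, a modified Tanaka quintuple is a sequence of vertices $(v_1,v_2,v_3,v_4,v_5)$ with $\{v_1,v_2\},\{v_3,v_4\}\in E$, $d(v_1,v_3)=d(v_2,v_4)=d(v_1,v_4)-1=d(v_2,v_3)-1$, $d(v_5,v_2)=d(v_5,v_1)+1$ and $d(v_5,v_3)=d(v_5,v_4)$. For integers $\alpha,\beta,\gamma\ge1$ with at most one equal to $1$, the theta graph $\Theta(\alpha,\beta,\gamma)$ is obtained from three paths $(x_0,\dots,x_\alpha)$, $(y_0,\dots,y_\beta)$, $(z_0,\dots,z_\gamma)$ by identifying $x_0=y_0=z_0$ and $x_\alpha=y_\beta=z_\gamma$, all other vertices being distinct. -}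

module Defs where

open import Data.Nat using (ℕ; zero; suc; _≤_; _<_; _<?_)
open import Data.Nat.Divisibility using (_∣_)
open import Data.Product using (Σ; _×_; _,_; ∃)
open import Data.Sum using (_⊎_)
open import Relation.Nullary using (yes; no)
open import Relation.Binary.PropositionalEquality using (_≡_)

Even : ℕ → Set
Even n = 2 ∣ n

Odd : ℕ → Set
Odd n = 2 ∣ suc n

-- The theta graph Θ(α,β,γ)
-- Three paths X = (x_0..x_α), Y = (y_0..y_β), Z = (z_0..z_γ) glued at
-- both ends: x_0 = y_0 = z_0 (= src) and x_α = y_β = z_γ (= tgt).

data PathName : Set where
  X Y Z : PathName

len : ℕ → ℕ → ℕ → PathName → ℕ
len α β γ X = α
len α β γ Y = β
len α β γ Z = γ

-- Vertices: the two glued endpoints, and the inner vertex of index i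
-- (0 < i < length) of each path (bounds are irrelevant, so two inner
-- vertices are equal iff same path and same index).
data ThetaV (α β γ : ℕ) : Set where
  src : ThetaV α β γ
  tgt : ThetaV α β γ
  inner : (p : PathName) (i : ℕ) → .(0 < i) → .(i < len α β γ p) → ThetaV α β γ

-- pt p i is the i-th vertex of path p (for 0 ≤ i ≤ length of p;
-- indices beyond the length are sent to the end vertex).
pt : {α β γ : ℕ} → PathName → ℕ → ThetaV α β γ
pt p zero = src
pt {α} {β} {γ} p (suc i) with suc i <? len α β γ p
... | yes lt = inner p (suc i) (Data.Nat.s≤s Data.Nat.z≤n) lt
... | no _ = tgt

Adj : {α β γ : ℕ} → ThetaV α β γ → ThetaV α β γ → Set
Adj {α} {β} {γ} u v =
  Σ PathName λ p → Σ ℕ λ i → i < len α β γ p ×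
    ((u ≡ pt p i × v ≡ pt p (suc i)) ⊎ (u ≡ pt p (suc i) × v ≡ pt p i))

data Walk {V : Set} (E : V → V → Set) : V → V → ℕ → Set where
  here : ∀ {u} → Walk E u u 0
  step : ∀ {u w v n} → E u w → Walk E w v n → Walk E u v (suc n)

Dist : {V : Set} (E : V → V → Set) → V → V → ℕ → Set
Dist E u v n = Walk E u v n × (∀ m → Walk E u v m → n ≤ m)

ModifiedTanaka : {V : Set} (E : V → V → Set) → V → V → V → V → V → Set
ModifiedTanaka E v₁ v₂ v₃ v₄ v₅ =
  E v₁ v₂ × E v₃ v₄ ×
  (∃ λ k → Dist E v₁ v₃ k × Dist E v₂ v₄ k × Dist E v₁ v₄ (suc k) × Dist E v₂ v₃ (suc k)) ×
  (∃ λ m → Dist E v₅ v₁ m × Dist E v₅ v₂ (suc m)) ×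
  (∃ λ l → Dist E v₅ v₃ l × Dist E v₅ v₄ l)

-- In a theta graph, let u lie i steps from src and k steps from tgt along one
-- path, and v lie j steps from src and l steps from tgt along another.  If the
-- path of u is a shortest way from u to both ends, then d(u,v) = min(i+j, k+l):
-- walks through src or through tgt give the upper bound, and the lower bound
-- comes from a potential on the vertices that grows by at most one along each
-- edge, vanishes at u and equals min(i+j, k+l) at v.  In Θ(e+2p, e+2b, e+1+2c)
-- with e ≥ 2 (e = 2 and e = 3 are the two parity cases) this formula verifies
-- all distance equations for the quintuple x_p, x_{p+1}, y_{e+b-1}, y_{e+b}, z_{c+1}.
module Submission where

open import Defs
open import Data.Nat using (ℕ; zero; suc; _+_; _⊓_; _≤_; _<_; _<?_; ∣_-_∣; z≤n; s≤s)
open import Data.Nat.Properties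
open import Data.Nat.Divisibility using (divides)
open import Data.Nat.Tactic.RingSolver using (solve)
open import Data.List using (List; _∷_; [])
open import Data.Product using (Σ; _×_; _,_; ∃; proj₁; proj₂)
open import Data.Sum using (_⊎_; inj₁; inj₂)
open import Data.Empty using (⊥-elim)
open import Relation.Nullary using (yes; no)
open import Relation.Binary.PropositionalEquality

module _ {V : Set} {E : V → V → Set} where

  _++ʷ_ : ∀ {u v w m n} → Walk E u v m → Walk E v w n → Walk E u w (m + n)
  here     ++ʷ w′ = w′
  step e w ++ʷ w′ = step e (w ++ʷ w′)

  snocʷ : ∀ {u v w n} → Walk E u v n → E v w → Walk E u w (suc n)
  snocʷ here        e = step e here
  snocʷ (step e′ w) e = step e′ (snocʷ w e)

  reverseʷ : (∀ {u v} → E u v → E v u) → ∀ {u v n} → Walk E u v n → Walk E v u n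
  reverseʷ E-sym here       = here
  reverseʷ E-sym (step e w) = snocʷ (reverseʷ E-sym w) (E-sym e)

  lipschitz⇒≤walk-length : (f : V → ℕ) → (∀ {u v} → E u v → f v ≤ suc (f u)) →
                           ∀ {u v n} → Walk E u v n → f v ≤ f u + n
  lipschitz⇒≤walk-length f lip {u} here = m≤m+n (f u) 0
  lipschitz⇒≤walk-length f lip {u} {v} (step {w = w} {n = n} e walk) = begin
    f v           ≤⟨ lipschitz⇒≤walk-length f lip walk ⟩
    f w + n       ≤⟨ +-monoˡ-≤ n (lip e) ⟩
    suc (f u) + n ≡⟨ +-suc (f u) n ⟨
    f u + suc n   ∎
    where open ≤-Reasoning

OneLipschitz : (ℕ → ℕ) → Set
OneLipschitz f = ∀ j → f (suc j) ≤ suc (f j) × f j ≤ suc (f (suc j))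

id-oneLipschitz : OneLipschitz (λ j → j)
id-oneLipschitz j = ≤-refl , m≤n⇒m≤1+n (n≤1+n j)

+-oneLipschitz : ∀ c {f} → OneLipschitz f → OneLipschitz (λ j → c + f j)
+-oneLipschitz c {f} lip j =
  ≤-trans (+-monoʳ-≤ c (proj₁ (lip j))) (≤-reflexive (+-suc c (f j))) ,
  ≤-trans (+-monoʳ-≤ c (proj₂ (lip j))) (≤-reflexive (+-suc c (f (suc j))))

⊓-oneLipschitz : ∀ {f g} → OneLipschitz f → OneLipschitz g → OneLipschitz (λ j → f j ⊓ g j)
⊓-oneLipschitz lf lg j =
  ⊓-mono-≤ (proj₁ (lf j)) (proj₁ (lg j)) , ⊓-mono-≤ (proj₂ (lf j)) (proj₂ (lg j))

∣n-1+n∣≡1 : ∀ n → ∣ n - suc n ∣ ≡ 1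
∣n-1+n∣≡1 zero    = refl
∣n-1+n∣≡1 (suc n) = ∣n-1+n∣≡1 n

∣-∣-oneLipschitz : ∀ i → OneLipschitz (λ j → ∣ i - j ∣)
∣-∣-oneLipschitz i j =
  ≤-trans (∣-∣-triangle i j (suc j)) (≤-reflexive (unit-step ∣ i - j ∣ (∣n-1+n∣≡1 j))) ,
  ≤-trans (∣-∣-triangle i (suc j) j)
          (≤-reflexive (unit-step ∣ i - suc j ∣ (trans (∣-∣-comm (suc j) j) (∣n-1+n∣≡1 j))))
  where
  unit-step : ∀ m {d} → d ≡ 1 → m + d ≡ suc m
  unit-step m refl = +-comm m 1

data Distinct : PathName → PathName → Set where
  xy : Distinct X Y
  xz : Distinct X Z
  yx : Distinct Y X
  yz : Distinct Y Z
  zx : Distinct Z X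
  zy : Distinct Z Y

compare : (q r : PathName) → q ≡ r ⊎ Distinct q r
compare X X = inj₁ refl
compare X Y = inj₂ xy
compare X Z = inj₂ xz
compare Y X = inj₂ yx
compare Y Y = inj₁ refl
compare Y Z = inj₂ yz
compare Z X = inj₂ zx
compare Z Y = inj₂ zy
compare Z Z = inj₁ refl

module ThetaGraph {α β γ : ℕ} where

  Θ : Set
  Θ = ThetaV α β γ

  L : PathName → ℕ
  L = len α β γ

  at : PathName → ℕ → Θ
  at = pt {α} {β} {γ}

  _~_ : Θ → Θ → Set
  _~_ = Adj {α} {β} {γ}

  ~-sym : ∀ {u v} → u ~ v → v ~ u
  ~-sym (r , j , lt , inj₁ (eu , ev)) = r , j , lt , inj₂ (ev , eu)
  ~-sym (r , j , lt , inj₂ (eu , ev)) = r , j , lt , inj₁ (ev , eu)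

  at-length : ∀ r j → suc j ≡ L r → at r (suc j) ≡ tgt
  at-length r j eq with suc j <? L r
  ... | yes lt = ⊥-elim (<-irrefl eq lt)
  ... | no _   = refl

  walk-to-src : ∀ r j → j ≤ L r → Walk _~_ (at r j) src j
  walk-to-src r zero    _  = here
  walk-to-src r (suc j) lt = step (r , j , lt , inj₂ (refl , refl)) (walk-to-src r j (<⇒≤ lt))

  walk-to-tgt : ∀ r → 0 < L r → ∀ j k → j + k ≡ L r → Walk _~_ (at r j) tgt k
  walk-to-tgt r pos zero    zero    eq = ⊥-elim (<-irrefl eq pos)
  walk-to-tgt r pos (suc j) zero    eq =
    subst (λ v → Walk _~_ v tgt 0) (sym (at-length r j (trans (sym (+-identityʳ (suc j))) eq))) here
  walk-to-tgt r pos j       (suc k) eq =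
    step (r , j , ≤-trans (s≤s (m≤m+n j k)) (≤-reflexive eq′) , inj₁ (refl , refl))
         (walk-to-tgt r pos (suc j) k eq′)
    where
    eq′ : suc j + k ≡ L r
    eq′ = trans (sym (+-suc j k)) eq

  -- Lower bound for the distance from at q i (where i + k ≡ L q) to at r j.
  along : PathName → ℕ → ℕ → PathName → ℕ → ℕ
  along q i k r j with compare q r
  ... | inj₁ _ = ∣ i - j ∣
  ... | inj₂ _ = (i + j) ⊓ (k + ∣ L r - j ∣)

  along-self : ∀ q i k j → along q i k q j ≡ ∣ i - j ∣
  along-self X i k j = refl
  along-self Y i k j = refl
  along-self Z i k j = refl

  along-distinct : ∀ {q r} → Distinct q r → ∀ i k j → along q i k r j ≡ (i + j) ⊓ (k + ∣ L r - j ∣)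
  along-distinct xy i k j = refl
  along-distinct xz i k j = refl
  along-distinct yx i k j = refl
  along-distinct yz i k j = refl
  along-distinct zx i k j = refl
  along-distinct zy i k j = refl

  along-oneLipschitz : ∀ q i k r → OneLipschitz (along q i k r)
  along-oneLipschitz q i k r with compare q r
  ... | inj₁ _ = ∣-∣-oneLipschitz i
  ... | inj₂ _ = ⊓-oneLipschitz (+-oneLipschitz i id-oneLipschitz)
                                (+-oneLipschitz k (∣-∣-oneLipschitz (L r)))

  potential : PathName → ℕ → ℕ → Θ → ℕ
  potential q i k src             = i
  potential q i k tgt             = k
  potential q i k (inner r j _ _) = along q i k r j

  GeodesicToEnds : PathName → ℕ → ℕ → Set
  GeodesicToEnds q i k = ∀ r → Distinct q r → i ≤ k + L r × k ≤ i + L r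

  module Potential {q i k} (split : i + k ≡ L q) (geodesic : GeodesicToEnds q i k) where

    along-src : ∀ r → along q i k r 0 ≡ i
    along-src r with compare q r
    ... | inj₁ refl = ∣-∣-identityʳ i
    ... | inj₂ d = begin
      (i + 0) ⊓ (k + ∣ L r - 0 ∣) ≡⟨ cong₂ (λ a b → a ⊓ (k + b)) (+-identityʳ i) (∣-∣-identityʳ (L r)) ⟩
      i ⊓ (k + L r)               ≡⟨ m≤n⇒m⊓n≡m (proj₁ (geodesic r d)) ⟩
      i                           ∎
      where open ≡-Reasoning

    along-tgt : ∀ r → along q i k r (L r) ≡ k
    along-tgt r with compare q r
    ... | inj₁ refl = trans (cong (∣ i -_∣) (sym split)) (∣m-m+n∣≡n i k)
    ... | inj₂ d = begin
      (i + L r) ⊓ (k + ∣ L r - L r ∣) ≡⟨ cong (λ b → (i + L r) ⊓ (k + b)) (∣n-n∣≡0 (L r)) ⟩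
      (i + L r) ⊓ (k + 0)             ≡⟨ cong ((i + L r) ⊓_) (+-identityʳ k) ⟩
      (i + L r) ⊓ k                   ≡⟨ m≥n⇒m⊓n≡n (proj₂ (geodesic r d)) ⟩
      k                               ∎
      where open ≡-Reasoning

    potential-at : ∀ r j → j ≤ L r → potential q i k (at r j) ≡ along q i k r j
    potential-at r zero    _  = sym (along-src r)
    potential-at r (suc j) le with suc j <? L r
    ... | yes _ = refl
    ... | no ¬lt = trans (sym (along-tgt r)) (cong (along q i k r) (≤-antisym (≮⇒≥ ¬lt) le))

    potential-oneLipschitz : ∀ {u v} → u ~ v → potential q i k v ≤ suc (potential q i k u)
    potential-oneLipschitz (r , j , lt , inj₁ (refl , refl))
      rewrite potential-at r j (<⇒≤ lt) | potential-at r (suc j) lt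
      = proj₁ (along-oneLipschitz q i k r j)
    potential-oneLipschitz (r , j , lt , inj₂ (refl , refl))
      rewrite potential-at r j (<⇒≤ lt) | potential-at r (suc j) lt
      = proj₂ (along-oneLipschitz q i k r j)

    potential-self : potential q i k (at q i) ≡ 0
    potential-self = begin
      potential q i k (at q i) ≡⟨ potential-at q i (m+n≤o⇒m≤o i (≤-reflexive split)) ⟩
      along q i k q i          ≡⟨ along-self q i k i ⟩
      ∣ i - i ∣                ≡⟨ ∣n-n∣≡0 i ⟩
      0                        ∎
      where open ≡-Reasoning

    potential≤walk-length : ∀ {v m} → Walk _~_ (at q i) v m → potential q i k v ≤ m
    potential≤walk-length {v} {m} walk = begin
      potential q i k v
        ≤⟨ lipschitz⇒≤walk-length (potential q i k) potential-oneLipschitz walk ⟩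
      potential q i k (at q i) + m ≡⟨ cong (_+ m) potential-self ⟩
      m                            ∎
      where open ≤-Reasoning

  cross-distance-≥ : ∀ {q r i k j l m} → Distinct q r → i + k ≡ L q → j + l ≡ L r →
    GeodesicToEnds q i k → Walk _~_ (at q i) (at r j) m → (i + j) ⊓ (k + l) ≤ m
  cross-distance-≥ {q} {r} {i} {k} {j} {l} {m} d split split′ geodesic walk = begin
    (i + j) ⊓ (k + l)           ≡⟨ cong (λ x → (i + j) ⊓ (k + x)) ∣L-j∣≡l ⟨
    (i + j) ⊓ (k + ∣ L r - j ∣) ≡⟨ along-distinct d i k j ⟨
    along q i k r j             ≡⟨ potential-at r j (m+n≤o⇒m≤o j (≤-reflexive split′)) ⟨
    potential q i k (at r j)    ≤⟨ potential≤walk-length walk ⟩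
    m                           ∎
    where
    open Potential split geodesic
    open ≤-Reasoning
    ∣L-j∣≡l : ∣ L r - j ∣ ≡ l
    ∣L-j∣≡l = trans (cong (λ x → ∣ x - j ∣) (sym split′))
                    (trans (∣-∣-comm (j + l) j) (∣m-m+n∣≡n j l))

  dist-via-src : ∀ {q r} → Distinct q r → ∀ i k j l n → i + k ≡ L q → j + l ≡ L r →
    GeodesicToEnds q i k → i + j ≡ n → n ≤ k + l → Dist _~_ (at q i) (at r j) n
  dist-via-src {q} {r} d i k j l n split split′ geodesic refl n≤ =
    walk-to-src q i (m+n≤o⇒m≤o i (≤-reflexive split)) ++ʷ
      reverseʷ ~-sym (walk-to-src r j (m+n≤o⇒m≤o j (≤-reflexive split′))) ,
    λ m walk → ≤-trans (⊓-glb ≤-refl n≤) (cross-distance-≥ d split split′ geodesic walk)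

  dist-via-tgt : ∀ {q r} → 0 < L q → 0 < L r → Distinct q r → ∀ i k j l n →
    i + k ≡ L q → j + l ≡ L r → GeodesicToEnds q i k → k + l ≡ n → n ≤ i + j →
    Dist _~_ (at q i) (at r j) n
  dist-via-tgt {q} {r} 0<Lq 0<Lr d i k j l n split split′ geodesic refl n≤ =
    walk-to-tgt q 0<Lq i k split ++ʷ reverseʷ ~-sym (walk-to-tgt r 0<Lr j l split′) ,
    λ m walk → ≤-trans (⊓-glb n≤ ≤-refl) (cross-distance-≥ d split split′ geodesic walk)

  geodesic-if-balanced : ∀ {e} → (∀ r → e ≤ L r) → ∀ {q i k} → i ≤ k + e → k ≤ i + e →
                         GeodesicToEnds q i k
  geodesic-if-balanced e≤L {k = k} i≤ k≤ r _ =
    ≤-trans i≤ (+-monoʳ-≤ k (e≤L r)) , ≤-trans k≤ (+-monoʳ-≤ _ (e≤L r))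

≤-offset : ∀ {m n} d → m + d ≡ n → m ≤ n
≤-offset {m} d refl = m≤m+n m d

TanakaQuintupleOnZ : ℕ → ℕ → ℕ → Set
TanakaQuintupleOnZ α β γ =
  Σ (ThetaV α β γ) λ v₁ → Σ (ThetaV α β γ) λ v₂ → Σ (ThetaV α β γ) λ v₃ →
  Σ (ThetaV α β γ) λ v₄ → Σ (ThetaV α β γ) λ v₅ →
    ModifiedTanaka (Adj {α} {β} {γ}) v₁ v₂ v₃ v₄ v₅ ×
    (∃ λ j → j ≤ γ × v₅ ≡ pt {α} {β} {γ} Z j)

-- The family of the header, with e = 2 + s.
tanaka-quintuple : ∀ s p b c →
  TanakaQuintupleOnZ (2 + s + (p + p)) (2 + s + (b + b)) (3 + s + (c + c))
tanaka-quintuple s p b c =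
  at X p , at X (suc p) , at Y (suc s + b) , at Y (2 + s + b) , at Z (suc c) ,
  (x-edge , y-edge ,
   (p + (suc s + b) , d₁₃ , d₂₄ , d₁₄ , d₂₃) ,
   (suc c + p , d₅₁ , d₅₂) ,
   (suc c + (suc s + b) , d₅₃ , d₅₄)) ,
  (suc c , ≤-offset (2 + s + c) (solve vars) , refl)
  where
  open ThetaGraph {2 + s + (p + p)} {2 + s + (b + b)} {3 + s + (c + c)}
  vars : List ℕ
  vars = s ∷ p ∷ b ∷ c ∷ []

  e≤L : ∀ r → 2 + s ≤ L r
  e≤L X = m≤m+n (2 + s) (p + p)
  e≤L Y = m≤m+n (2 + s) (b + b)
  e≤L Z = m≤n⇒m≤1+n (m≤m+n (2 + s) (c + c))

  0<L : ∀ r → 0 < L r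
  0<L r = ≤-trans (s≤s z≤n) (e≤L r)

  x-edge : at X p ~ at X (suc p)
  x-edge = X , p , p<α , inj₁ (refl , refl)
    where
    p<α : suc p ≤ 2 + s + (p + p)
    p<α = ≤-offset (1 + s + p) (solve vars)

  y-edge : at Y (suc s + b) ~ at Y (2 + s + b)
  y-edge = Y , suc s + b , s+b<β , inj₁ (refl , refl)
    where
    s+b<β : 2 + s + b ≤ 2 + s + (b + b)
    s+b<β = ≤-offset b (solve vars)

  split₁ : p + (2 + s + p) ≡ 2 + s + (p + p)
  split₁ = solve vars
  split₂ : suc p + (suc s + p) ≡ 2 + s + (p + p)
  split₂ = solve vars
  split₃ : suc s + b + suc b ≡ 2 + s + (b + b)
  split₃ = solve vars
  split₄ : 2 + s + b + b ≡ 2 + s + (b + b)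
  split₄ = solve vars
  split₅ : suc c + (2 + s + c) ≡ 3 + s + (c + c)
  split₅ = solve vars

  geodesic₁ : GeodesicToEnds X p (2 + s + p)
  geodesic₁ = geodesic-if-balanced e≤L {X} {p} {2 + s + p}
    (≤-offset (4 + s + s) (solve vars)) (≤-reflexive (+-comm (2 + s) p))
  geodesic₂ : GeodesicToEnds X (suc p) (suc s + p)
  geodesic₂ = geodesic-if-balanced e≤L {X} {suc p} {suc s + p}
    (≤-offset (2 + s + s) (solve vars)) (≤-offset 2 (solve vars))
  geodesic₅ : GeodesicToEnds Z (suc c) (2 + s + c)
  geodesic₅ = geodesic-if-balanced e≤L {Z} {suc c} {2 + s + c}
    (≤-offset (3 + s + s) (solve vars)) (≤-offset 1 (solve vars))

  d₁₃ : Dist _~_ (at X p) (at Y (suc s + b)) (p + (suc s + b))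
  d₁₃ = dist-via-src xy p (2 + s + p) (suc s + b) (suc b) (p + (suc s + b))
          split₁ split₃ geodesic₁ refl (≤-offset 2 (solve vars))
  d₂₄ : Dist _~_ (at X (suc p)) (at Y (2 + s + b)) (p + (suc s + b))
  d₂₄ = dist-via-tgt (0<L X) (0<L Y) xy (suc p) (suc s + p) (2 + s + b) b (p + (suc s + b))
          split₂ split₄ geodesic₂ (solve vars) (≤-offset 2 (solve vars))
  d₁₄ : Dist _~_ (at X p) (at Y (2 + s + b)) (suc (p + (suc s + b)))
  d₁₄ = dist-via-src xy p (2 + s + p) (2 + s + b) b (suc (p + (suc s + b)))
          split₁ split₄ geodesic₁ (solve vars) (≤-offset 0 (solve vars))
  d₂₃ : Dist _~_ (at X (suc p)) (at Y (suc s + b)) (suc (p + (suc s + b)))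
  d₂₃ = dist-via-src xy (suc p) (suc s + p) (suc s + b) (suc b) (suc (p + (suc s + b)))
          split₂ split₃ geodesic₂ refl (≤-offset 0 (solve vars))
  d₅₁ : Dist _~_ (at Z (suc c)) (at X p) (suc c + p)
  d₅₁ = dist-via-src zx (suc c) (2 + s + c) p (2 + s + p) (suc c + p)
          split₅ split₁ geodesic₅ refl (≤-offset (3 + s + s) (solve vars))
  d₅₂ : Dist _~_ (at Z (suc c)) (at X (suc p)) (suc (suc c + p))
  d₅₂ = dist-via-src zx (suc c) (2 + s + c) (suc p) (suc s + p) (suc (suc c + p))
          split₅ split₂ geodesic₅ (solve vars) (≤-offset (1 + s + s) (solve vars))
  d₅₃ : Dist _~_ (at Z (suc c)) (at Y (suc s + b)) (suc c + (suc s + b))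
  d₅₃ = dist-via-src zy (suc c) (2 + s + c) (suc s + b) (suc b) (suc c + (suc s + b))
          split₅ split₃ geodesic₅ refl (≤-offset 1 (solve vars))
  d₅₄ : Dist _~_ (at Z (suc c)) (at Y (2 + s + b)) (suc c + (suc s + b))
  d₅₄ = dist-via-tgt (0<L Z) (0<L Y) zy (suc c) (2 + s + c) (2 + s + b) b (suc c + (suc s + b))
          split₅ split₄ geodesic₅ (solve vars) (≤-offset 1 (solve vars))

even-from-2 : ∀ n → 2 ≤ n → Even n → ∃ λ p → n ≡ 2 + (p + p)
even-from-2 n _      (divides (suc p) eq) = p , trans eq (solve (p ∷ []))
even-from-2 _ ()     (divides zero refl)

odd-from-3 : ∀ n → 2 ≤ n → Odd n → ∃ λ p → n ≡ 3 + (p + p)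
odd-from-3 n _       (divides (suc (suc p)) eq) = p , trans (suc-injective eq) (solve (p ∷ []))
odd-from-3 _ (s≤s ()) (divides (suc zero) refl)

even-from-4 : ∀ n → 4 ≤ n → Even n → ∃ λ p → n ≡ 4 + (p + p)
even-from-4 n _      (divides (suc (suc p)) eq) = p , trans eq (solve (p ∷ []))
even-from-4 _ ()     (divides zero refl)
even-from-4 _ (s≤s (s≤s ())) (divides (suc zero) refl)

theorem6p6 : (α β γ : ℕ) → 2 ≤ α → 2 ≤ β → 2 ≤ γ →
    ((Even α × Even β × Odd γ) ⊎ (Odd α × Odd β × Even γ × 4 ≤ γ)) →
    Σ (ThetaV α β γ) λ v₁ → Σ (ThetaV α β γ) λ v₂ → Σ (ThetaV α β γ) λ v₃ →
    Σ (ThetaV α β γ) λ v₄ → Σ (ThetaV α β γ) λ v₅ →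
      ModifiedTanaka (Adj {α} {β} {γ}) v₁ v₂ v₃ v₄ v₅ ×
      (∃ λ j → j ≤ γ × v₅ ≡ pt {α} {β} {γ} Z j)
theorem6p6 α β γ 2≤α 2≤β 2≤γ (inj₁ (α-even , β-even , γ-odd))
  with even-from-2 α 2≤α α-even | even-from-2 β 2≤β β-even | odd-from-3 γ 2≤γ γ-odd
... | p , refl | b , refl | c , refl = tanaka-quintuple 0 p b c
theorem6p6 α β γ 2≤α 2≤β _ (inj₂ (α-odd , β-odd , γ-even , 4≤γ))
  with odd-from-3 α 2≤α α-odd | odd-from-3 β 2≤β β-odd | even-from-4 γ 4≤γ γ-even
... | p , refl | b , refl | c , refl = tanaka-quintuple 1 p b c
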